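{- Let $\mathscr{C}\subset\mathbb{F}_2^{24}$ be the extended binary Golay code, and regard its codewords as $0$-$1$ vectors in $\mathbb{R}^{24}$. There exists a subset $H\subset\mathscr{C}$ containing exactly one codeword from each complementary pair $\{c,\mathbf{1}+c\}$ (where $\mathbf{1}$ is the all-ones word, which lies in $\mathscr{C}$) such that $\sum_{c\in H}c=\frac12\sum_{c\in\mathscr{C}}c$ in $\mathbb{R}^{24}$.
   Context: The extended Golay code $\mathscr{C}$ is the binary linear $[24,12,8]$ code; e.g. it is generated by the matrix $G=[I\ P]$ where $I$ is the $12\times12$ identity matrix and $P=J-A$ with $J$ the all-ones $12\times 12$ matrix and $A$ the adjacency matrix of the icosahedron graph. -}

module Defs where

open import Data.Bool using (Bool; true; false; not; _∧_; _∨_; _xor_; if_then_else_)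
open import Data.Nat using (ℕ; zero; suc; _+_; _*_; _≡ᵇ_)
open import Data.Fin using (Fin; toℕ)
open import Data.Vec using (Vec; []; _∷_; tabulate; lookup; replicate; zipWith; _++_)
open import Data.List using (List; []; _∷_; map; foldr) renaming (_++_ to _++ˡ_)
open import Data.Bool.ListAction using (any)
open import Data.Product using (_×_; _,_)

icoEdges : List (ℕ × ℕ)
icoEdges =
  (0 , 1) ∷ (0 , 2) ∷ (0 , 3) ∷ (0 , 4) ∷ (0 , 5) ∷
  (1 , 2) ∷ (2 , 3) ∷ (3 , 4) ∷ (4 , 5) ∷ (5 , 1) ∷
  (6 , 7) ∷ (7 , 8) ∷ (8 , 9) ∷ (9 , 10) ∷ (10 , 6) ∷
  (11 , 6) ∷ (11 , 7) ∷ (11 , 8) ∷ (11 , 9) ∷ (11 , 10) ∷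
  (1 , 6) ∷ (1 , 7) ∷ (2 , 7) ∷ (2 , 8) ∷ (3 , 8) ∷ (3 , 9) ∷
  (4 , 9) ∷ (4 , 10) ∷ (5 , 10) ∷ (5 , 6) ∷ []

adj : Fin 12 → Fin 12 → Bool
adj i j = any (λ { (a , b) → ((a ≡ᵇ toℕ i) ∧ (b ≡ᵇ toℕ j)) ∨ ((a ≡ᵇ toℕ j) ∧ (b ≡ᵇ toℕ i)) }) icoEdges

-- P = J - A over F₂
P : Fin 12 → Fin 12 → Bool
P i j = not (adj i j)

xorSum : ∀ {n} → Vec Bool n → (Fin n → Bool) → Bool
xorSum [] f = false
xorSum (x ∷ xs) f = (x ∧ f Data.Fin.zero) xor xorSum xs (λ k → f (Data.Fin.suc k))

encode : Vec Bool 12 → Vec Bool 24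
encode m = m ++ tabulate (λ j → xorSum m (λ i → P i j))

allWords : (n : ℕ) → List (Vec Bool n)
allWords zero = [] ∷ []
allWords (suc n) = map (false ∷_) (allWords n) ++ˡ map (true ∷_) (allWords n)

golay : List (Vec Bool 24)
golay = map encode (allWords 12)

complement : ∀ {n} → Vec Bool n → Vec Bool n
complement = Data.Vec.map not

b2n : Bool → ℕ
b2n true = 1
b2n false = 0

vsum : ∀ {n} → List (Vec Bool n) → Vec ℕ n
vsum {n} = foldr (λ c acc → zipWith _+_ (Data.Vec.map b2n c) acc) (replicate n 0)

-- Take H to be the codewords m G whose message m satisfies m₀ + m₁ + m₂ = 0.
-- Since every column of P has odd weight, 1 + m G = (1 + m) G, and flipping
-- all of m flips m₀ + m₁ + m₂, so H contains exactly one word of each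
-- complementary pair. Coordinate j of a codeword is a linear functional f_j
-- of the message, and f_j is never 0 or equal to w = m₀ + m₁ + m₂. For two
-- such independent functionals, translating by a message v with f_j(v) = 0
-- and w(v) = 1 swaps {f_j = 1, w = 0} with {f_j = 1, w = 1}, so H hits
-- coordinate j exactly half as often as the whole code does.
module Submission where

open import Defs
open import Algebra using (CommutativeRing)
import Algebra.Properties.CommutativeSemigroup as CommutativeSemigroupProperties
open import Data.Bool using (Bool; true; false; not; _xor_; _∧_; if_then_else_)
open import Data.Bool.Properties as Bool
  using (xor-∧-commutativeRing; ∧-distribʳ-xor; ∧-identityʳ; xor-identityʳ; ∧-zeroʳ; not-involutive; not-¬)
open import Data.Fin using (Fin; zero; suc; toℕ; splitAt)
open import Data.Fin.Properties using (_≟_; all?)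
open import Data.List using (List; []; _∷_; filter)
import Data.List as List
open import Data.List.Properties using (map-++; map-∘; map-cong)
open import Data.List.Membership.Propositional using (_∈_)
open import Data.List.Membership.Propositional.Properties using (∈-map⁺; ∈-map⁻; ∈-filter⁺; ∈-filter⁻; ∈-++⁺ˡ; ∈-++⁺ʳ)
open import Data.List.Relation.Unary.All as All using (All)
open import Data.List.Relation.Unary.AllPairs using ([]; _∷_)
open import Data.List.Relation.Unary.Any using (here; any?; satisfied)
open import Data.List.Relation.Unary.Unique.Propositional using (Unique)
open import Data.List.Relation.Unary.Unique.Propositional.Properties using (map⁺; filter⁺; ++⁺)
open import Data.Nat using (ℕ; zero; suc; _+_; _*_; _<ᵇ_)
open import Data.Nat.ListAction using (sum)
open import Data.Nat.ListAction.Properties using (sum-++)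
open import Data.Nat.Properties using (+-comm; +-identityʳ; +-commutativeSemigroup)
open import Data.Product using (Σ; ∃; _×_; _,_; proj₂)
open import Data.Sum using (_⊎_; inj₁; inj₂; [_,_]′)
open import Data.Vec using (Vec; []; _∷_; _++_; map; zipWith; replicate; tabulate; lookup)
open import Data.Vec.Properties
  using (lookup-map; lookup-zipWith; lookup-replicate; lookup-splitAt; lookup∘tabulate; tabulate∘lookup; tabulate-cong; tabulate-∘; ++-injectiveˡ; ∷-injectiveʳ)
  renaming (map-++ to map-++ᵛ)
open import Function using (_∘_)
open import Relation.Binary.PropositionalEquality using (_≡_; refl; sym; trans; cong; cong₂; subst; module ≡-Reasoning)
open import Relation.Nullary using (¬_; Dec; does)
open import Relation.Nullary.Decidable using (toWitness; _×-dec_)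
open ≡-Reasoning

open CommutativeSemigroupProperties (CommutativeRing.+-commutativeSemigroup xor-∧-commutativeRing)
  using () renaming (interchange to xor-interchange)
open CommutativeSemigroupProperties +-commutativeSemigroup
  using () renaming (interchange to +-interchange)

_⊕_ : ∀ {n} → Vec Bool n → Vec Bool n → Vec Bool n
_⊕_ = zipWith _xor_

xorSum-⊕ : ∀ {n} (m v : Vec Bool n) f → xorSum (m ⊕ v) f ≡ xorSum m f xor xorSum v f
xorSum-⊕ []      []      f = refl
xorSum-⊕ (x ∷ m) (y ∷ v) f = begin
  ((x xor y) ∧ f zero) xor xorSum (m ⊕ v) (f ∘ suc)
    ≡⟨ cong₂ _xor_ (∧-distribʳ-xor (f zero) x y) (xorSum-⊕ m v (f ∘ suc)) ⟩
  ((x ∧ f zero) xor (y ∧ f zero)) xor (xorSum m (f ∘ suc) xor xorSum v (f ∘ suc))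
    ≡⟨ xor-interchange (x ∧ f zero) (y ∧ f zero) _ _ ⟩
  xorSum (x ∷ m) f xor xorSum (y ∷ v) f ∎

xorSum-zeroʳ : ∀ {n} (m : Vec Bool n) → xorSum m (λ _ → false) ≡ false
xorSum-zeroʳ []      = refl
xorSum-zeroʳ (x ∷ m) = trans (cong (_xor xorSum m (λ _ → false)) (∧-zeroʳ x)) (xorSum-zeroʳ m)

lookup-as-xorSum : ∀ {n} (m : Vec Bool n) k → lookup m k ≡ xorSum m (λ i → does (i ≟ k))
lookup-as-xorSum (x ∷ m) zero = sym (begin
  (x ∧ true) xor xorSum m (λ _ → false) ≡⟨ cong₂ _xor_ (∧-identityʳ x) (xorSum-zeroʳ m) ⟩
  x xor false                            ≡⟨ xor-identityʳ x ⟩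
  x                                      ∎)
lookup-as-xorSum (x ∷ m) (suc k) =
  trans (lookup-as-xorSum m k) (cong (_xor xorSum m (λ i → does (i ≟ k))) (sym (∧-zeroʳ x)))

complement-as-⊕ : ∀ {n} (m : Vec Bool n) → complement m ≡ replicate n true ⊕ m
complement-as-⊕ []      = refl
complement-as-⊕ (x ∷ m) = cong (not x ∷_) (complement-as-⊕ m)

xorSum-complement : ∀ {n} (m : Vec Bool n) f → xorSum (replicate n true) f ≡ true →
                    xorSum (complement m) f ≡ not (xorSum m f)
xorSum-complement {n} m f odd = begin
  xorSum (complement m) f                            ≡⟨ cong (λ u → xorSum u f) (complement-as-⊕ m) ⟩
  xorSum (replicate n true ⊕ m) f                    ≡⟨ xorSum-⊕ (replicate n true) m f ⟩
  xorSum (replicate n true) f xor xorSum m f         ≡⟨ cong (_xor xorSum m f) odd ⟩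
  not (xorSum m f)                                   ∎

allWords-complete : ∀ {n} (v : Vec Bool n) → v ∈ allWords n
allWords-complete []          = here refl
allWords-complete (false ∷ v) = ∈-++⁺ˡ (∈-map⁺ (false ∷_) (allWords-complete v))
allWords-complete {suc n} (true ∷ v) =
  ∈-++⁺ʳ (List.map (false ∷_) (allWords n)) (∈-map⁺ (true ∷_) (allWords-complete v))

allWords-unique : ∀ n → Unique (allWords n)
allWords-unique zero    = All.[] ∷ []
allWords-unique (suc n) = ++⁺ (map⁺ ∷-injectiveʳ (allWords-unique n)) (map⁺ ∷-injectiveʳ (allWords-unique n)) disjoint
  where
  disjoint : ∀ {v} → ¬ (v ∈ List.map (false ∷_) (allWords n) × v ∈ List.map (true ∷_) (allWords n))
  disjoint (p , q) with ∈-map⁻ (false ∷_) p | ∈-map⁻ (true ∷_) q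
  ... | _ , _ , refl | _ , _ , ()

sum-map-+ : ∀ {A : Set} (g h : A → ℕ) xs →
            sum (List.map (λ x → g x + h x) xs) ≡ sum (List.map g xs) + sum (List.map h xs)
sum-map-+ g h []       = refl
sum-map-+ g h (x ∷ xs) =
  trans (cong (g x + h x +_) (sum-map-+ g h xs)) (+-interchange (g x) (h x) _ _)

sum-map-filter : ∀ {A : Set} (p : A → Bool) (g : A → ℕ) xs →
                 sum (List.map g (filter (λ x → p x Bool.≟ false) xs))
                 ≡ sum (List.map (λ x → if p x then 0 else g x) xs)
sum-map-filter p g []       = refl
sum-map-filter p g (x ∷ xs) with p x
... | false = cong (g x +_) (sum-map-filter p g xs)
... | true  = sum-map-filter p g xs

sumOverWords : ∀ n → (Vec Bool n → ℕ) → ℕ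
sumOverWords n g = sum (List.map g (allWords n))

sumOverWords-cong : ∀ {n} {g h : Vec Bool n → ℕ} → (∀ m → g m ≡ h m) → sumOverWords n g ≡ sumOverWords n h
sumOverWords-cong {n} g≗h = cong sum (map-cong g≗h (allWords n))

sumOverWords-suc : ∀ {n} (g : Vec Bool (suc n) → ℕ) →
  sumOverWords (suc n) g ≡ sumOverWords n (g ∘ (false ∷_)) + sumOverWords n (g ∘ (true ∷_))
sumOverWords-suc {n} g = begin
  sum (List.map g (List.map (false ∷_) W List.++ List.map (true ∷_) W))
    ≡⟨ cong sum (map-++ g (List.map (false ∷_) W) _) ⟩
  sum (List.map g (List.map (false ∷_) W) List.++ List.map g (List.map (true ∷_) W))
    ≡⟨ sum-++ (List.map g (List.map (false ∷_) W)) _ ⟩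
  sum (List.map g (List.map (false ∷_) W)) + sum (List.map g (List.map (true ∷_) W))
    ≡⟨ sym (cong₂ _+_ (cong sum (map-∘ W)) (cong sum (map-∘ W))) ⟩
  sumOverWords n (g ∘ (false ∷_)) + sumOverWords n (g ∘ (true ∷_)) ∎
  where W = allWords n

sumOverWords-translate : ∀ {n} (v : Vec Bool n) (g : Vec Bool n → ℕ) →
                         sumOverWords n (λ m → g (v ⊕ m)) ≡ sumOverWords n g
sumOverWords-translate []      g = refl
sumOverWords-translate {suc n} (b ∷ v) g = begin
  sumOverWords (suc n) (λ m → g ((b ∷ v) ⊕ m))
    ≡⟨ sumOverWords-suc (λ m → g ((b ∷ v) ⊕ m)) ⟩
  S (λ m → g ((b xor false) ∷ v ⊕ m)) + S (λ m → g ((b xor true) ∷ v ⊕ m))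
    ≡⟨ cong₂ _+_ (sumOverWords-translate v (g ∘ ((b xor false) ∷_)))
                 (sumOverWords-translate v (g ∘ ((b xor true) ∷_))) ⟩
  S (g ∘ ((b xor false) ∷_)) + S (g ∘ ((b xor true) ∷_))
    ≡⟨ halves b ⟩
  S (g ∘ (false ∷_)) + S (g ∘ (true ∷_))
    ≡⟨ sym (sumOverWords-suc g) ⟩
  sumOverWords (suc n) g ∎
  where
  S = sumOverWords n
  halves : ∀ b → S (g ∘ ((b xor false) ∷_)) + S (g ∘ ((b xor true) ∷_)) ≡ S (g ∘ (false ∷_)) + S (g ∘ (true ∷_))
  halves false = refl
  halves true  = +-comm (S (g ∘ (true ∷_))) _

-- Translation by v is a bijection exchanging {f = 1, w = 0} and {f = 1, w = 1}.
sumOverWords-half : ∀ {n} (f w : Fin n → Bool) (v : Vec Bool n) → xorSum v f ≡ false → xorSum v w ≡ true →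
  2 * sumOverWords n (λ m → b2n (not (xorSum m w) ∧ xorSum m f)) ≡ sumOverWords n (λ m → b2n (xorSum m f))
sumOverWords-half {n} f w v vf≡0 vw≡1 = begin
  2 * A           ≡⟨ cong (A +_) (+-identityʳ A) ⟩
  A + A           ≡⟨ cong (A +_) A≡B ⟩
  A + B           ≡⟨ sym (sum-map-+ _ _ (allWords n)) ⟩
  sumOverWords n (λ m → b2n (not (xorSum m w) ∧ xorSum m f) + b2n (xorSum m w ∧ xorSum m f))
                  ≡⟨ sumOverWords-cong (λ m → b2n-split (xorSum m w) (xorSum m f)) ⟩
  sumOverWords n (λ m → b2n (xorSum m f)) ∎
  where
  A = sumOverWords n (λ m → b2n (not (xorSum m w) ∧ xorSum m f))
  B = sumOverWords n (λ m → b2n (xorSum m w ∧ xorSum m f))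

  b2n-split : ∀ y x → b2n (not y ∧ x) + b2n (y ∧ x) ≡ b2n x
  b2n-split false x = +-identityʳ (b2n x)
  b2n-split true  x = refl

  translated : ∀ m → b2n (not (xorSum (v ⊕ m) w) ∧ xorSum (v ⊕ m) f) ≡ b2n (xorSum m w ∧ xorSum m f)
  translated m rewrite xorSum-⊕ v m w | xorSum-⊕ v m f | vw≡1 | vf≡0 =
    cong (λ y → b2n (y ∧ xorSum m f)) (not-involutive (xorSum m w))

  A≡B : A ≡ B
  A≡B = trans (sym (sumOverWords-translate v _)) (sumOverWords-cong translated)

column : Fin 24 → Fin 12 → Bool
column j = [ (λ k i → does (i ≟ k)) , (λ k i → P i k) ]′ (splitAt 12 j)

lookup-encode : ∀ m j → lookup (encode m) j ≡ xorSum m (column j)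
lookup-encode m j rewrite lookup-splitAt 12 m (tabulate (λ k → xorSum m (λ i → P i k))) j with splitAt 12 j
... | inj₁ k = lookup-as-xorSum m k
... | inj₂ k = lookup∘tabulate (λ k → xorSum m (λ i → P i k)) k

encode-injective : ∀ {m m′} → encode m ≡ encode m′ → m ≡ m′
encode-injective {m} {m′} = ++-injectiveˡ m m′

oddColumns : ∀ k → xorSum (replicate 12 true) (λ i → P i k) ≡ true
oddColumns = toWitness {a? = all? (λ k → xorSum (replicate 12 true) (λ i → P i k) Bool.≟ true)} _

encode-complement : ∀ m → complement (encode m) ≡ encode (complement m)
encode-complement m = begin
  map not (m ++ tabulate check)              ≡⟨ map-++ᵛ not m (tabulate check) ⟩
  complement m ++ map not (tabulate check)   ≡⟨ cong (complement m ++_) (sym (tabulate-∘ not check)) ⟩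
  complement m ++ tabulate (not ∘ check)     ≡⟨ cong (complement m ++_) (tabulate-cong complemented) ⟩
  encode (complement m)                      ∎
  where
  check : Fin 12 → Bool
  check k = xorSum m (λ i → P i k)
  complemented : ∀ k → not (check k) ≡ xorSum (complement m) (λ i → P i k)
  complemented k = sym (xorSum-complement m (λ i → P i k) (oddColumns k))

firstThree : Fin 12 → Bool
firstThree i = toℕ i <ᵇ 3

firstThree-complement : ∀ m → xorSum (complement m) firstThree ≡ not (xorSum m firstThree)
firstThree-complement m = xorSum-complement m firstThree refl

separating : ∀ j → ∃ λ v → xorSum v (column j) ≡ false × xorSum v firstThree ≡ true
separating j = satisfied (separated j)
  where
  separated = toWitness
    {a? = all? (λ j → any? (λ v → (xorSum v (column j) Bool.≟ false) ×-dec (xorSum v firstThree Bool.≟ true))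
                          (allWords 12))} _

inHalf? : (m : Vec Bool 12) → Dec (xorSum m firstThree ≡ false)
inHalf? m = xorSum m firstThree Bool.≟ false

halfMessages : List (Vec Bool 12)
halfMessages = filter inHalf? (allWords 12)

halfCode : List (Vec Bool 24)
halfCode = List.map encode halfMessages

encode-∈-halfCode⁺ : ∀ m → xorSum m firstThree ≡ false → encode m ∈ halfCode
encode-∈-halfCode⁺ m w≡0 = ∈-map⁺ encode (∈-filter⁺ inHalf? (allWords-complete m) w≡0)

encode-∈-halfCode⁻ : ∀ m → encode m ∈ halfCode → xorSum m firstThree ≡ false
encode-∈-halfCode⁻ m m∈ =
  let (m′ , m′∈ , eq) = ∈-map⁻ encode {xs = halfMessages} m∈
  in subst (λ u → xorSum u firstThree ≡ false) (sym (encode-injective eq))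
           (proj₂ (∈-filter⁻ inHalf? {xs = allWords 12} m′∈))

halfCode⊆golay : ∀ {c} → c ∈ halfCode → c ∈ golay
halfCode⊆golay c∈ =
  let (m , _ , c≡) = ∈-map⁻ encode {xs = halfMessages} c∈
  in subst (_∈ golay) (sym c≡) (∈-map⁺ encode (allWords-complete m))

halfCode-picks-one : ∀ c → c ∈ golay →
                     (c ∈ halfCode ⊎ complement c ∈ halfCode) × ¬ (c ∈ halfCode × complement c ∈ halfCode)
halfCode-picks-one c c∈ =
  let (m , _ , c≡) = ∈-map⁻ encode {xs = allWords 12} c∈
  in subst (λ c → (c ∈ halfCode ⊎ complement c ∈ halfCode) × ¬ (c ∈ halfCode × complement c ∈ halfCode))
           (sym c≡) (picks m (xorSum m firstThree) refl , λ (p , q) →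
             not-¬ (sym (encode-∈-halfCode⁻ m p)) (sym (complement-rejected m q)))
  where
  complement-rejected : ∀ m → complement (encode m) ∈ halfCode → not (xorSum m firstThree) ≡ false
  complement-rejected m q = trans (sym (firstThree-complement m))
    (encode-∈-halfCode⁻ (complement m) (subst (_∈ halfCode) (encode-complement m) q))

  picks : ∀ m b → xorSum m firstThree ≡ b → encode m ∈ halfCode ⊎ complement (encode m) ∈ halfCode
  picks m false w≡0 = inj₁ (encode-∈-halfCode⁺ m w≡0)
  picks m true  w≡1 = inj₂ (subst (_∈ halfCode) (sym (encode-complement m))
                        (encode-∈-halfCode⁺ (complement m) (trans (firstThree-complement m) (cong not w≡1))))

lookup-vsum : ∀ {n} (cs : List (Vec Bool n)) j → lookup (vsum cs) j ≡ sum (List.map (λ c → b2n (lookup c j)) cs)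
lookup-vsum []       j = lookup-replicate j 0
lookup-vsum (c ∷ cs) j =
  trans (lookup-zipWith _+_ j (map b2n c) (vsum cs)) (cong₂ _+_ (lookup-map j b2n c) (lookup-vsum cs j))

lookup-vsum-golay : ∀ j → lookup (vsum golay) j ≡ sumOverWords 12 (λ m → b2n (xorSum m (column j)))
lookup-vsum-golay j = begin
  lookup (vsum golay) j
    ≡⟨ lookup-vsum golay j ⟩
  sum (List.map (λ c → b2n (lookup c j)) golay)
    ≡⟨ cong sum (sym (map-∘ {g = λ c → b2n (lookup c j)} {f = encode} (allWords 12))) ⟩
  sumOverWords 12 (λ m → b2n (lookup (encode m) j))
    ≡⟨ sumOverWords-cong (cong b2n ∘ (λ m → lookup-encode m j)) ⟩
  sumOverWords 12 (λ m → b2n (xorSum m (column j))) ∎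

lookup-vsum-halfCode : ∀ j →
  lookup (vsum halfCode) j ≡ sumOverWords 12 (λ m → b2n (not (xorSum m firstThree) ∧ xorSum m (column j)))
lookup-vsum-halfCode j = begin
  lookup (vsum halfCode) j
    ≡⟨ lookup-vsum halfCode j ⟩
  sum (List.map (λ c → b2n (lookup c j)) halfCode)
    ≡⟨ cong sum (sym (map-∘ {g = λ c → b2n (lookup c j)} {f = encode} halfMessages)) ⟩
  sum (List.map (λ m → b2n (lookup (encode m) j)) halfMessages)
    ≡⟨ sum-map-filter (λ m → xorSum m firstThree) (λ m → b2n (lookup (encode m) j)) (allWords 12) ⟩
  sumOverWords 12 (λ m → if xorSum m firstThree then 0 else b2n (lookup (encode m) j))
    ≡⟨ sumOverWords-cong (λ m → as-∧ (xorSum m firstThree) (lookup-encode m j)) ⟩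
  sumOverWords 12 (λ m → b2n (not (xorSum m firstThree) ∧ xorSum m (column j))) ∎
  where
  as-∧ : ∀ y {a b} → a ≡ b → (if y then 0 else b2n a) ≡ b2n (not y ∧ b)
  as-∧ false refl = refl
  as-∧ true  _    = refl

vec-ext : ∀ {n} {xs ys : Vec ℕ n} → (∀ j → lookup xs j ≡ lookup ys j) → xs ≡ ys
vec-ext {xs = xs} {ys} eq = trans (sym (tabulate∘lookup xs)) (trans (tabulate-cong eq) (tabulate∘lookup ys))

halfCode-halves-vsum : map (2 *_) (vsum halfCode) ≡ vsum golay
halfCode-halves-vsum = vec-ext λ j →
  let (v , vf≡0 , vw≡1) = separating j in begin
  lookup (map (2 *_) (vsum halfCode)) j                         ≡⟨ lookup-map j (2 *_) (vsum halfCode) ⟩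
  2 * lookup (vsum halfCode) j                                  ≡⟨ cong (2 *_) (lookup-vsum-halfCode j) ⟩
  2 * sumOverWords 12 (λ m → b2n (not (xorSum m firstThree) ∧ xorSum m (column j)))
                                                                ≡⟨ sumOverWords-half (column j) firstThree v vf≡0 vw≡1 ⟩
  sumOverWords 12 (λ m → b2n (xorSum m (column j)))             ≡⟨ sym (lookup-vsum-golay j) ⟩
  lookup (vsum golay) j                                         ∎

lemma3p1 : Σ (List (Vec Bool 24)) (λ H →
             Unique H
             × All (λ c → c ∈ golay) H
             × (∀ c → c ∈ golay → (c ∈ H ⊎ complement c ∈ H) × ¬ (c ∈ H × complement c ∈ H))
             × map (2 *_) (vsum H) ≡ vsum golay)
lemma3p1 = halfCode
         , map⁺ encode-injective (filter⁺ inHalf? (allWords-unique 12))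
         , All.tabulate halfCode⊆golay
         , halfCode-picks-one
         , halfCode-halves-vsum
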